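{- For any integers $n>k\ge0$, $$[2k+1]_q\begin{bmatrix}2k\\k\end{bmatrix}_q\sum_{h=0}^{n-1}q^h\begin{bmatrix}h\\k\end{bmatrix}_q^2\equiv0\pmod{[n]_q}$$ in $\mathbb Z[q]$, and hence $$(2k+1)\binom{2k}k\sum_{h=0}^{n-1}\binom hk^2\equiv0\pmod n.$$
   Context: $[m]_q=(1-q^m)/(1-q)$ for $m\in\mathbb Z$; $\begin{bmatrix}m\\0\end{bmatrix}_q=1$ and $\begin{bmatrix}m\\k\end{bmatrix}_q=\prod_{j=0}^{k-1}[m-j]_q/\prod_{j=1}^k[j]_q$ for $k\ge1$ (a polynomial in $\mathbb Z[q]$ for $m,k\in\mathbb N$, equal to $0$ when $m<k$). -}

module Defs where

open import Data.Nat using (ℕ; zero; suc; _∸_)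
import Data.Nat
open import Data.Integer using (ℤ; 0ℤ; 1ℤ) renaming (_+_ to _+ℤ_; _*_ to _*ℤ_)
open import Data.List using (List; []; _∷_; replicate; map; _++_)
open import Data.Product using (∃)
open import Relation.Binary.PropositionalEquality using (_≡_)

-- Polynomials in ℤ[q] as coefficient lists: the i-th entry is the
-- coefficient of q^i.  Trailing zeros are allowed; equality of
-- polynomials is coefficientwise (_≈ₚ_).
Poly : Set
Poly = List ℤ

coeff : Poly → ℕ → ℤ
coeff []       _       = 0ℤ
coeff (a ∷ as) zero    = a
coeff (a ∷ as) (suc i) = coeff as i

_≈ₚ_ : Poly → Poly → Set
A ≈ₚ B = ∀ i → coeff A i ≡ coeff B i

infixl 6 _+ₚ_
infixl 7 _*ₚ_
infix 4 _≈ₚ_ _∣ₚ_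

_+ₚ_ : Poly → Poly → Poly
[]       +ₚ B        = B
(a ∷ as) +ₚ []       = a ∷ as
(a ∷ as) +ₚ (b ∷ bs) = (a +ℤ b) ∷ (as +ₚ bs)

scaleₚ : ℤ → Poly → Poly
scaleₚ c = map (c *ℤ_)

_*ₚ_ : Poly → Poly → Poly
[]       *ₚ B = []
(a ∷ as) *ₚ B = scaleₚ a B +ₚ (0ℤ ∷ (as *ₚ B))

oneₚ : Poly
oneₚ = 1ℤ ∷ []

qpow : ℕ → Poly
qpow h = replicate h 0ℤ ++ (1ℤ ∷ [])

-- q-integer [m]_q = (1 - q^m)/(1 - q) = 1 + q + ... + q^(m-1), for m ∈ ℕ
qint : ℕ → Poly
qint m = replicate m 1ℤ

prodFrom : ℕ → ℕ → (ℕ → Poly) → Poly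
prodFrom lo zero      f = oneₚ
prodFrom lo (suc len) f = f lo *ₚ prodFrom (suc lo) len f

sumₚ : ℕ → (ℕ → Poly) → Poly
sumₚ zero    f = []
sumₚ (suc n) f = sumₚ n f +ₚ f n

_∣ₚ_ : Poly → Poly → Set
B ∣ₚ A = ∃ λ (C : Poly) → A ≈ₚ C *ₚ B

-- P is the Gaussian binomial coefficient [m choose k]_q, i.e.
--   P = ∏_{j=0}^{k-1} [m-j]_q / ∏_{j=1}^{k} [j]_q,
-- expressed (since ℤ[q] is an integral domain and ∏[j]_q ≠ 0) as
--   P · ∏_{j=1}^{k}[j]_q = ∏_{j=0}^{k-1}[m-j]_q.
-- For j ≤ k-1 and m < k the factor j = m gives [0]_q = 0, so truncated
-- subtraction m ∸ j only matters when some factor is already 0.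
IsQBinom : ℕ → ℕ → Poly → Set
IsQBinom m k P =
  P *ₚ prodFrom 1 k qint ≈ₚ prodFrom 0 k (λ j → qint (m ∸ j))

sumℕ : ℕ → (ℕ → ℕ) → ℕ
sumℕ zero    f = 0
sumℕ (suc n) f = sumℕ n f Data.Nat.+ f n

-- The q-binomial [m, k] is
-- defined by the q-Pascal rule; cancellation shows it is the polynomial
-- characterised by IsQBinom and gives the factorial formula, absorption
-- [k+1][m+1, k+1] = [m+1][m, k], the second Pascal rule, the hockey-stick
-- identity ∑_{h<n} q^h [h, m] = q^m [n, m+1], q-Vandermonde and trinomial
-- revision.  These linearise
--   [h, k]² = ∑_{c≤k} q^((k-c)²) [k, c] [2k-c, k] [h, 2k-c],
-- turning the weighted sum into ∑_{c≤k} (…) q^m [n, m+1] with m = 2k-c.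
-- The identity [2k+1][2k, k][k, c] = [m+1][2k+1, c][m, k] and absorption
-- [m+1][n, m+1] = [n][n-1, m] make every term a multiple of [n].  The
-- integer statement follows by evaluating at q = 1.
module Submission where

open import Defs
open import Data.Nat using (ℕ; zero; suc; _<_; _+_; _*_; _∸_; s≤s; z≤n)
open import Data.Nat.Properties
  using (m<n⇒m<1+n; n<1+n; +-suc; +-identityʳ; +-comm; m+n∸m≡n; ≤-pred; <⇒≱; *-zeroʳ; +-assoc; <-≤-trans; m≤m+n; +-monoʳ-<)
open import Data.Nat.Tactic.RingSolver using () renaming (solve-∀ to ℕ-solve-∀)
open import Data.Empty using (⊥-elim)
open import Data.Nat.Divisibility using (_∣_; divides)
open import Data.Nat.Combinatorics using (_C_; nCk+nC[k+1]≡[n+1]C[k+1])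
open import Data.Product using (_×_; _,_)

open import Data.Integer using (ℤ; +_; 0ℤ; 1ℤ; ∣_∣) renaming (_+_ to infixl 6 _+ℤ_; _*_ to infixl 7 _*ℤ_)
import Data.Integer.Properties as ℤP
open import Data.Integer.Tactic.RingSolver using (solve-∀)
open import Algebra.Bundles using (AbelianGroup; CommutativeSemiring)
open import Algebra.Structures using (IsCommutativeMonoid)
open import Algebra.Structures.Biased using (isCommutativeSemiringˡ)
open import Algebra.Properties.Group (AbelianGroup.group ℤP.+-0-abelianGroup)
  using () renaming (∙-cancelˡ to +ℤ-cancelˡ)
open import Data.List using ([]; _∷_)
open import Relation.Binary using (IsEquivalence)
import Relation.Binary.Reasoning.Setoid as SetoidReasoning
import Algebra.Solver.Ring.NaturalCoefficients.Default as SemiringSolver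
open import Relation.Binary.PropositionalEquality
  using (_≡_; refl; sym; trans; cong; cong₂; subst; module ≡-Reasoning)

shift : Poly → Poly
shift A = 0ℤ ∷ A

-- Equality of polynomials packed in a record: unlike the function type
-- A ≈ₚ B, the type A ≋ B determines A and B, so they can be inferred.
infix 4 _≋_
record _≋_ (A B : Poly) : Set where
  constructor mk
  field coeffs : A ≈ₚ B
open _≋_ public

≋-refl : ∀ {A} → A ≋ A
≋-refl = mk λ _ → refl

≋-sym : ∀ {A B} → A ≋ B → B ≋ A
≋-sym (mk p) = mk λ i → sym (p i)

≋-trans : ∀ {A B E} → A ≋ B → B ≋ E → A ≋ E
≋-trans (mk p) (mk q) = mk λ i → trans (p i) (q i)

≡⇒≋ : ∀ {A B} → A ≡ B → A ≋ B
≡⇒≋ refl = ≋-refl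

coeff-+ₚ : ∀ A B i → coeff (A +ₚ B) i ≡ coeff A i +ℤ coeff B i
coeff-+ₚ []       B        i       = sym (ℤP.+-identityˡ _)
coeff-+ₚ (a ∷ as) []       i       = sym (ℤP.+-identityʳ _)
coeff-+ₚ (a ∷ as) (b ∷ bs) zero    = refl
coeff-+ₚ (a ∷ as) (b ∷ bs) (suc i) = coeff-+ₚ as bs i

coeff-scale : ∀ c A i → coeff (scaleₚ c A) i ≡ c *ℤ coeff A i
coeff-scale c []       i       = sym (ℤP.*-zeroʳ c)
coeff-scale c (a ∷ as) zero    = refl
coeff-scale c (a ∷ as) (suc i) = coeff-scale c as i

coeff-*ₚ-zero : ∀ a as B → coeff ((a ∷ as) *ₚ B) 0 ≡ a *ℤ coeff B 0
coeff-*ₚ-zero a as B = begin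
  coeff (scaleₚ a B +ₚ shift (as *ₚ B)) 0  ≡⟨ coeff-+ₚ (scaleₚ a B) _ 0 ⟩
  coeff (scaleₚ a B) 0 +ℤ 0ℤ                ≡⟨ ℤP.+-identityʳ _ ⟩
  coeff (scaleₚ a B) 0                      ≡⟨ coeff-scale a B 0 ⟩
  a *ℤ coeff B 0                            ∎
  where open ≡-Reasoning

coeff-*ₚ-suc : ∀ a as B i →
  coeff ((a ∷ as) *ₚ B) (suc i) ≡ a *ℤ coeff B (suc i) +ℤ coeff (as *ₚ B) i
coeff-*ₚ-suc a as B i = trans (coeff-+ₚ (scaleₚ a B) (shift (as *ₚ B)) (suc i))
  (cong (_+ℤ coeff (as *ₚ B) i) (coeff-scale a B (suc i)))

+ₚ-cong : ∀ {A A′ B B′} → A ≋ A′ → B ≋ B′ → A +ₚ B ≋ A′ +ₚ B′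
+ₚ-cong {A} {A′} {B} {B′} (mk p) (mk q) = mk λ i →
  trans (coeff-+ₚ A B i) (trans (cong₂ _+ℤ_ (p i) (q i)) (sym (coeff-+ₚ A′ B′ i)))

+ₚ-comm : ∀ A B → A +ₚ B ≋ B +ₚ A
+ₚ-comm A B = mk λ i → trans (coeff-+ₚ A B i)
  (trans (ℤP.+-comm (coeff A i) (coeff B i)) (sym (coeff-+ₚ B A i)))

+ₚ-assoc : ∀ A B E → (A +ₚ B) +ₚ E ≋ A +ₚ (B +ₚ E)
+ₚ-assoc A B E = mk λ i → begin
  coeff ((A +ₚ B) +ₚ E) i                    ≡⟨ coeff-+ₚ (A +ₚ B) E i ⟩
  coeff (A +ₚ B) i +ℤ coeff E i              ≡⟨ cong (_+ℤ coeff E i) (coeff-+ₚ A B i) ⟩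
  (coeff A i +ℤ coeff B i) +ℤ coeff E i      ≡⟨ ℤP.+-assoc (coeff A i) _ _ ⟩
  coeff A i +ℤ (coeff B i +ℤ coeff E i)      ≡⟨ cong (coeff A i +ℤ_) (coeff-+ₚ B E i) ⟨
  coeff A i +ℤ coeff (B +ₚ E) i              ≡⟨ coeff-+ₚ A (B +ₚ E) i ⟨
  coeff (A +ₚ (B +ₚ E)) i                    ∎
  where open ≡-Reasoning

+ₚ-identityʳ : ∀ A → A +ₚ [] ≋ A
+ₚ-identityʳ A = mk λ i → trans (coeff-+ₚ A [] i) (ℤP.+-identityʳ _)

shift-cong : ∀ {A B} → A ≋ B → shift A ≋ shift B
shift-cong (mk p) = mk λ { zero → refl ; (suc i) → p i }

*ₚ-vanishingˡ : ∀ A B → (∀ i → coeff A i ≡ 0ℤ) → A *ₚ B ≈ₚ []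
*ₚ-vanishingˡ []       B z i       = refl
*ₚ-vanishingˡ (a ∷ as) B z zero    =
  trans (coeff-*ₚ-zero a as B) (cong (_*ℤ coeff B 0) (z 0))
*ₚ-vanishingˡ (a ∷ as) B z (suc i) = trans (coeff-*ₚ-suc a as B i)
  (cong₂ _+ℤ_ (cong (_*ℤ coeff B (suc i)) (z 0)) (*ₚ-vanishingˡ as B (λ j → z (suc j)) i))

-- Multiplication respects _≈ₚ_ in each argument; lists equal up to
-- trailing zeros are handled through *ₚ-vanishingˡ.
*ₚ-congˡ : ∀ A A′ B → A ≈ₚ A′ → A *ₚ B ≈ₚ A′ *ₚ B
*ₚ-congˡ []       []         B p i       = refl
*ₚ-congˡ []       (a′ ∷ as′) B p i       =
  sym (*ₚ-vanishingˡ (a′ ∷ as′) B (λ j → sym (p j)) i)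
*ₚ-congˡ (a ∷ as) []         B p         = *ₚ-vanishingˡ (a ∷ as) B p
*ₚ-congˡ (a ∷ as) (a′ ∷ as′) B p zero    = trans (coeff-*ₚ-zero a as B)
  (trans (cong (_*ℤ coeff B 0) (p 0)) (sym (coeff-*ₚ-zero a′ as′ B)))
*ₚ-congˡ (a ∷ as) (a′ ∷ as′) B p (suc i) = trans (coeff-*ₚ-suc a as B i)
  (trans (cong₂ _+ℤ_ (cong (_*ℤ coeff B (suc i)) (p 0))
                     (*ₚ-congˡ as as′ B (λ j → p (suc j)) i))
         (sym (coeff-*ₚ-suc a′ as′ B i)))

*ₚ-congʳ : ∀ A B B′ → B ≈ₚ B′ → A *ₚ B ≈ₚ A *ₚ B′
*ₚ-congʳ []       B B′ p i       = refl
*ₚ-congʳ (a ∷ as) B B′ p zero    = trans (coeff-*ₚ-zero a as B)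
  (trans (cong (a *ℤ_) (p 0)) (sym (coeff-*ₚ-zero a as B′)))
*ₚ-congʳ (a ∷ as) B B′ p (suc i) = trans (coeff-*ₚ-suc a as B i)
  (trans (cong₂ _+ℤ_ (cong (a *ℤ_) (p (suc i))) (*ₚ-congʳ as B B′ p i))
         (sym (coeff-*ₚ-suc a as B′ i)))

*ₚ-cong : ∀ {A A′ B B′} → A ≋ A′ → B ≋ B′ → A *ₚ B ≋ A′ *ₚ B′
*ₚ-cong {A} {A′} {B} {B′} (mk p) (mk q) =
  mk λ i → trans (*ₚ-congˡ A A′ B p i) (*ₚ-congʳ A′ B B′ q i)

*ₚ-zeroʳ : ∀ A → A *ₚ [] ≋ []
*ₚ-zeroʳ A = mk (go A)
  where
  go : ∀ A → A *ₚ [] ≈ₚ []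
  go []       i       = refl
  go (a ∷ as) zero    = refl
  go (a ∷ as) (suc i) = go as i

*ₚ-identityˡ : ∀ A → oneₚ *ₚ A ≋ A
*ₚ-identityˡ A = mk λ i → begin
  coeff (scaleₚ 1ℤ A +ₚ shift []) i          ≡⟨ coeff-+ₚ (scaleₚ 1ℤ A) (shift []) i ⟩
  coeff (scaleₚ 1ℤ A) i +ℤ coeff (shift []) i ≡⟨ cong₂ _+ℤ_ (coeff-scale 1ℤ A i) (shift-[] i) ⟩
  1ℤ *ℤ coeff A i +ℤ 0ℤ                       ≡⟨ ℤP.+-identityʳ _ ⟩
  1ℤ *ℤ coeff A i                             ≡⟨ ℤP.*-identityˡ _ ⟩
  coeff A i                                   ∎
  where
  open ≡-Reasoning
  shift-[] : ∀ i → coeff (shift []) i ≡ 0ℤ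
  shift-[] zero    = refl
  shift-[] (suc i) = refl

*ₚ-distribʳ : ∀ E A B → (A +ₚ B) *ₚ E ≋ A *ₚ E +ₚ B *ₚ E
*ₚ-distribʳ E A B = mk (go A B)
  where
  rearrange : ∀ a b e x y → (a +ℤ b) *ℤ e +ℤ (x +ℤ y) ≡ (a *ℤ e +ℤ x) +ℤ (b *ℤ e +ℤ y)
  rearrange = solve-∀
  go : ∀ A B → (A +ₚ B) *ₚ E ≈ₚ A *ₚ E +ₚ B *ₚ E
  go []       B        i       = refl
  go (a ∷ as) []       i       = sym (coeffs (+ₚ-identityʳ ((a ∷ as) *ₚ E)) i)
  go (a ∷ as) (b ∷ bs) zero    = begin
    coeff ((a +ℤ b ∷ as +ₚ bs) *ₚ E) 0               ≡⟨ coeff-*ₚ-zero (a +ℤ b) (as +ₚ bs) E ⟩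
    (a +ℤ b) *ℤ coeff E 0                            ≡⟨ ℤP.*-distribʳ-+ (coeff E 0) a b ⟩
    a *ℤ coeff E 0 +ℤ b *ℤ coeff E 0                 ≡⟨ cong₂ _+ℤ_ (coeff-*ₚ-zero a as E) (coeff-*ₚ-zero b bs E) ⟨
    coeff ((a ∷ as) *ₚ E) 0 +ℤ coeff ((b ∷ bs) *ₚ E) 0 ≡⟨ coeff-+ₚ ((a ∷ as) *ₚ E) ((b ∷ bs) *ₚ E) 0 ⟨
    coeff ((a ∷ as) *ₚ E +ₚ (b ∷ bs) *ₚ E) 0         ∎
    where open ≡-Reasoning
  go (a ∷ as) (b ∷ bs) (suc i) = begin
    coeff ((a +ℤ b ∷ as +ₚ bs) *ₚ E) (suc i)
      ≡⟨ coeff-*ₚ-suc (a +ℤ b) (as +ₚ bs) E i ⟩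
    (a +ℤ b) *ℤ e +ℤ coeff ((as +ₚ bs) *ₚ E) i
      ≡⟨ cong ((a +ℤ b) *ℤ e +ℤ_) (trans (go as bs i) (coeff-+ₚ (as *ₚ E) (bs *ₚ E) i)) ⟩
    (a +ℤ b) *ℤ e +ℤ (coeff (as *ₚ E) i +ℤ coeff (bs *ₚ E) i)
      ≡⟨ rearrange a b e (coeff (as *ₚ E) i) (coeff (bs *ₚ E) i) ⟩
    (a *ℤ e +ℤ coeff (as *ₚ E) i) +ℤ (b *ℤ e +ℤ coeff (bs *ₚ E) i)
      ≡⟨ cong₂ _+ℤ_ (coeff-*ₚ-suc a as E i) (coeff-*ₚ-suc b bs E i) ⟨
    coeff ((a ∷ as) *ₚ E) (suc i) +ℤ coeff ((b ∷ bs) *ₚ E) (suc i)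
      ≡⟨ coeff-+ₚ ((a ∷ as) *ₚ E) ((b ∷ bs) *ₚ E) (suc i) ⟨
    coeff ((a ∷ as) *ₚ E +ₚ (b ∷ bs) *ₚ E) (suc i)
      ∎
    where
    open ≡-Reasoning
    e = coeff E (suc i)

*ₚ-∷ʳ : ∀ B a as → B *ₚ (a ∷ as) ≈ₚ scaleₚ a B +ₚ shift (B *ₚ as)
*ₚ-∷ʳ []       a as zero    = refl
*ₚ-∷ʳ []       a as (suc i) = refl
*ₚ-∷ʳ (b ∷ bs) a as zero    = begin
  coeff ((b ∷ bs) *ₚ (a ∷ as)) 0 ≡⟨ coeff-*ₚ-zero b bs (a ∷ as) ⟩
  b *ℤ a                         ≡⟨ ℤP.*-comm b a ⟩
  a *ℤ b                         ≡⟨ ℤP.+-identityʳ _ ⟨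
  a *ℤ b +ℤ 0ℤ                   ≡⟨ coeff-+ₚ (scaleₚ a (b ∷ bs)) (shift ((b ∷ bs) *ₚ as)) 0 ⟨
  coeff (scaleₚ a (b ∷ bs) +ₚ shift ((b ∷ bs) *ₚ as)) 0 ∎
  where open ≡-Reasoning
*ₚ-∷ʳ (b ∷ bs) a as (suc i) = begin
  coeff ((b ∷ bs) *ₚ (a ∷ as)) (suc i)
    ≡⟨ coeff-*ₚ-suc b bs (a ∷ as) i ⟩
  b *ℤ coeff as i +ℤ coeff (bs *ₚ (a ∷ as)) i
    ≡⟨ cong (b *ℤ coeff as i +ℤ_) (trans (*ₚ-∷ʳ bs a as i) (coeff-+ₚ (scaleₚ a bs) (shift (bs *ₚ as)) i)) ⟩
  b *ℤ coeff as i +ℤ (coeff (scaleₚ a bs) i +ℤ s)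
    ≡⟨ cong₂ (λ x y → y +ℤ (x +ℤ s)) (coeff-scale a bs i) (sym (coeff-scale b as i)) ⟩
  coeff (scaleₚ b as) i +ℤ (a *ℤ coeff bs i +ℤ s)
    ≡⟨ swap (coeff (scaleₚ b as) i) (a *ℤ coeff bs i) s ⟩
  a *ℤ coeff bs i +ℤ (coeff (scaleₚ b as) i +ℤ s)
    ≡⟨ cong₂ _+ℤ_ (sym (coeff-scale a bs i)) (sym (coeff-+ₚ (scaleₚ b as) (shift (bs *ₚ as)) i)) ⟩
  coeff (scaleₚ a bs) i +ℤ coeff ((b ∷ bs) *ₚ as) i
    ≡⟨ coeff-+ₚ (scaleₚ a (b ∷ bs)) (shift ((b ∷ bs) *ₚ as)) (suc i) ⟨
  coeff (scaleₚ a (b ∷ bs) +ₚ shift ((b ∷ bs) *ₚ as)) (suc i) ∎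
  where
  open ≡-Reasoning
  s = coeff (shift (bs *ₚ as)) i
  swap : ∀ x y z → x +ℤ (y +ℤ z) ≡ y +ℤ (x +ℤ z)
  swap = solve-∀

*ₚ-comm : ∀ A B → A *ₚ B ≋ B *ₚ A
*ₚ-comm []       B = ≋-sym (*ₚ-zeroʳ B)
*ₚ-comm (a ∷ as) B = ≋-trans (+ₚ-cong (≋-refl {scaleₚ a B}) (shift-cong (*ₚ-comm as B)))
                             (≋-sym (mk (*ₚ-∷ʳ B a as)))

scaleₚ-*ₚ : ∀ a A B → scaleₚ a A *ₚ B ≈ₚ scaleₚ a (A *ₚ B)
scaleₚ-*ₚ a []       B i       = refl
scaleₚ-*ₚ a (b ∷ bs) B zero    = begin
  coeff ((a *ℤ b ∷ scaleₚ a bs) *ₚ B) 0 ≡⟨ coeff-*ₚ-zero (a *ℤ b) (scaleₚ a bs) B ⟩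
  a *ℤ b *ℤ coeff B 0                   ≡⟨ ℤP.*-assoc a b _ ⟩
  a *ℤ (b *ℤ coeff B 0)                 ≡⟨ cong (a *ℤ_) (coeff-*ₚ-zero b bs B) ⟨
  a *ℤ coeff ((b ∷ bs) *ₚ B) 0          ≡⟨ coeff-scale a ((b ∷ bs) *ₚ B) 0 ⟨
  coeff (scaleₚ a ((b ∷ bs) *ₚ B)) 0    ∎
  where open ≡-Reasoning
scaleₚ-*ₚ a (b ∷ bs) B (suc i) = begin
  coeff ((a *ℤ b ∷ scaleₚ a bs) *ₚ B) (suc i)
    ≡⟨ coeff-*ₚ-suc (a *ℤ b) (scaleₚ a bs) B i ⟩
  a *ℤ b *ℤ coeff B (suc i) +ℤ coeff (scaleₚ a bs *ₚ B) i
    ≡⟨ cong (a *ℤ b *ℤ coeff B (suc i) +ℤ_) (trans (scaleₚ-*ₚ a bs B i) (coeff-scale a (bs *ₚ B) i)) ⟩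
  a *ℤ b *ℤ coeff B (suc i) +ℤ a *ℤ coeff (bs *ₚ B) i
    ≡⟨ factor a b (coeff B (suc i)) (coeff (bs *ₚ B) i) ⟩
  a *ℤ (b *ℤ coeff B (suc i) +ℤ coeff (bs *ₚ B) i)
    ≡⟨ cong (a *ℤ_) (coeff-*ₚ-suc b bs B i) ⟨
  a *ℤ coeff ((b ∷ bs) *ₚ B) (suc i)
    ≡⟨ coeff-scale a ((b ∷ bs) *ₚ B) (suc i) ⟨
  coeff (scaleₚ a ((b ∷ bs) *ₚ B)) (suc i) ∎
  where
  open ≡-Reasoning
  factor : ∀ a b c y → a *ℤ b *ℤ c +ℤ a *ℤ y ≡ a *ℤ (b *ℤ c +ℤ y)
  factor = solve-∀

shift-*ₚ : ∀ A B → shift A *ₚ B ≋ shift (A *ₚ B)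
shift-*ₚ A B = mk λ i → trans (coeff-+ₚ (scaleₚ 0ℤ B) (shift (A *ₚ B)) i)
  (trans (cong (_+ℤ coeff (shift (A *ₚ B)) i) (coeff-scale 0ℤ B i)) (ℤP.+-identityˡ _))

*ₚ-assoc : ∀ A B E → (A *ₚ B) *ₚ E ≋ A *ₚ (B *ₚ E)
*ₚ-assoc []       B E = ≋-refl
*ₚ-assoc (a ∷ as) B E = ≋-trans (*ₚ-distribʳ E (scaleₚ a B) (shift (as *ₚ B)))
  (+ₚ-cong {scaleₚ a B *ₚ E} (mk (scaleₚ-*ₚ a B E))
           (≋-trans (shift-*ₚ (as *ₚ B) E) (shift-cong (*ₚ-assoc as B E))))

≋-isEquivalence : IsEquivalence _≋_
≋-isEquivalence = record { refl = ≋-refl ; sym = ≋-sym ; trans = ≋-trans }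

+ₚ-isCommutativeMonoid : IsCommutativeMonoid _≋_ _+ₚ_ []
+ₚ-isCommutativeMonoid = record
  { isMonoid = record
    { isSemigroup = record
      { isMagma = record { isEquivalence = ≋-isEquivalence ; ∙-cong = +ₚ-cong }
      ; assoc   = +ₚ-assoc }
    ; identity = (λ _ → ≋-refl) , +ₚ-identityʳ }
  ; comm = +ₚ-comm }

*ₚ-isCommutativeMonoid : IsCommutativeMonoid _≋_ _*ₚ_ oneₚ
*ₚ-isCommutativeMonoid = record
  { isMonoid = record
    { isSemigroup = record
      { isMagma = record { isEquivalence = ≋-isEquivalence ; ∙-cong = *ₚ-cong }
      ; assoc   = *ₚ-assoc }
    ; identity = *ₚ-identityˡ , λ A → ≋-trans (*ₚ-comm A oneₚ) (*ₚ-identityˡ A) }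
  ; comm = *ₚ-comm }

ℤ[q] : CommutativeSemiring _ _
ℤ[q] = record
  { Carrier = Poly ; _≈_ = _≋_ ; _+_ = _+ₚ_ ; _*_ = _*ₚ_ ; 0# = [] ; 1# = oneₚ
  ; isCommutativeSemiring = isCommutativeSemiringˡ record
    { +-isCommutativeMonoid = +ₚ-isCommutativeMonoid
    ; *-isCommutativeMonoid = *ₚ-isCommutativeMonoid
    ; distribʳ              = *ₚ-distribʳ
    ; zeroˡ                 = λ _ → ≋-refl } }

open CommutativeSemiring ℤ[q] using (setoid) renaming (distribˡ to *ₚ-distribˡ)
open SemiringSolver ℤ[q] using (solve; _:+_; _:*_; _:=_)
module ≋-Reasoning = SetoidReasoning setoid

tailₚ : Poly → Poly
tailₚ []       = []
tailₚ (a ∷ as) = as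

coeff-tailₚ : ∀ A i → coeff A (suc i) ≡ coeff (tailₚ A) i
coeff-tailₚ []       i = refl
coeff-tailₚ (a ∷ as) i = refl

coeff₀-*ₚ : ∀ A B → coeff (A *ₚ B) 0 ≡ coeff A 0 *ℤ coeff B 0
coeff₀-*ₚ []       B = sym (ℤP.*-zeroˡ (coeff B 0))
coeff₀-*ₚ (a ∷ as) B = coeff-*ₚ-zero a as B

coeffₛ-*ₚ : ∀ A B i →
  coeff (A *ₚ B) (suc i) ≡ coeff A 0 *ℤ coeff B (suc i) +ℤ coeff (tailₚ A *ₚ B) i
coeffₛ-*ₚ []       B i = sym (trans (ℤP.+-identityʳ _) (ℤP.*-zeroˡ (coeff B (suc i))))
coeffₛ-*ₚ (a ∷ as) B i = coeff-*ₚ-suc a as B i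

HasUnitConstant : Poly → Set
HasUnitConstant F = coeff F 0 ≡ 1ℤ

unitConstant-*ₚ : ∀ F G → HasUnitConstant F → HasUnitConstant G → HasUnitConstant (F *ₚ G)
unitConstant-*ₚ F G f₀ g₀ = trans (coeff₀-*ₚ F G) (cong₂ _*ℤ_ f₀ g₀)

-- Cancellation of a factor with constant term 1 (such as a q-factorial),
-- by induction on the coefficient index: it transfers identities from
-- "multiplied out" form to the q-binomials themselves.
*ₚ-cancelʳ : ∀ F → HasUnitConstant F → ∀ {A B} → A *ₚ F ≋ B *ₚ F → A ≋ B
*ₚ-cancelʳ F f₀ {A} {B} (mk eq) = mk λ i → coefficient i A B eq
  where
  open ≡-Reasoning
  constant : ∀ A B → A *ₚ F ≈ₚ B *ₚ F → coeff A 0 ≡ coeff B 0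
  constant A B eq = begin
    coeff A 0               ≡⟨ ℤP.*-identityʳ _ ⟨
    coeff A 0 *ℤ 1ℤ         ≡⟨ cong (coeff A 0 *ℤ_) f₀ ⟨
    coeff A 0 *ℤ coeff F 0  ≡⟨ coeff₀-*ₚ A F ⟨
    coeff (A *ₚ F) 0        ≡⟨ eq 0 ⟩
    coeff (B *ₚ F) 0        ≡⟨ coeff₀-*ₚ B F ⟩
    coeff B 0 *ℤ coeff F 0  ≡⟨ cong (coeff B 0 *ℤ_) f₀ ⟩
    coeff B 0 *ℤ 1ℤ         ≡⟨ ℤP.*-identityʳ _ ⟩
    coeff B 0               ∎
  tails : ∀ A B → A *ₚ F ≈ₚ B *ₚ F → tailₚ A *ₚ F ≈ₚ tailₚ B *ₚ F
  tails A B eq j = +ℤ-cancelˡ (coeff A 0 *ℤ coeff F (suc j)) _ _ (begin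
    coeff A 0 *ℤ coeff F (suc j) +ℤ coeff (tailₚ A *ₚ F) j  ≡⟨ coeffₛ-*ₚ A F j ⟨
    coeff (A *ₚ F) (suc j)                                  ≡⟨ eq (suc j) ⟩
    coeff (B *ₚ F) (suc j)                                  ≡⟨ coeffₛ-*ₚ B F j ⟩
    coeff B 0 *ℤ coeff F (suc j) +ℤ coeff (tailₚ B *ₚ F) j
      ≡⟨ cong (λ c → c *ℤ coeff F (suc j) +ℤ coeff (tailₚ B *ₚ F) j) (constant A B eq) ⟨
    coeff A 0 *ℤ coeff F (suc j) +ℤ coeff (tailₚ B *ₚ F) j  ∎)
  coefficient : ∀ i A B → A *ₚ F ≈ₚ B *ₚ F → coeff A i ≡ coeff B i
  coefficient zero    A B eq = constant A B eq
  coefficient (suc i) A B eq = begin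
    coeff A (suc i)     ≡⟨ coeff-tailₚ A i ⟩
    coeff (tailₚ A) i   ≡⟨ coefficient i (tailₚ A) (tailₚ B) (tails A B eq) ⟩
    coeff (tailₚ B) i   ≡⟨ coeff-tailₚ B i ⟨
    coeff B (suc i)     ∎

shift-q : ∀ A → shift A ≋ qpow 1 *ₚ A
shift-q A = ≋-sym (≋-trans (shift-*ₚ oneₚ A) (shift-cong (*ₚ-identityˡ A)))

qpow-suc : ∀ a → qpow (suc a) ≋ qpow 1 *ₚ qpow a
qpow-suc a = shift-q (qpow a)

qint-suc : ∀ a → qint (suc a) ≋ oneₚ +ₚ qpow 1 *ₚ qint a
qint-suc a = ≋-trans (mk λ { zero → refl ; (suc i) → refl })
                     (+ₚ-cong (≋-refl {oneₚ}) (shift-q (qint a)))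

qpow-+ : ∀ a b → qpow (a + b) ≋ qpow a *ₚ qpow b
qpow-+ zero    b = ≋-sym (*ₚ-identityˡ (qpow b))
qpow-+ (suc a) b = begin
  qpow (suc a + b)             ≈⟨ qpow-suc (a + b) ⟩
  q *ₚ qpow (a + b)            ≈⟨ *ₚ-cong (≋-refl {q}) (qpow-+ a b) ⟩
  q *ₚ (qpow a *ₚ qpow b)      ≈⟨ *ₚ-assoc q (qpow a) (qpow b) ⟨
  (q *ₚ qpow a) *ₚ qpow b      ≈⟨ *ₚ-cong (qpow-suc a) ≋-refl ⟨
  qpow (suc a) *ₚ qpow b       ∎
  where
  open ≋-Reasoning
  q = qpow 1

qint-+ : ∀ a b → qint (a + b) ≋ qint a +ₚ qpow a *ₚ qint b
qint-+ zero    b = ≋-sym (*ₚ-identityˡ (qint b))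
qint-+ (suc a) b = begin
  qint (suc a + b)                             ≈⟨ qint-suc (a + b) ⟩
  oneₚ +ₚ q *ₚ qint (a + b)                    ≈⟨ +ₚ-cong (≋-refl {oneₚ}) (*ₚ-cong (≋-refl {q}) (qint-+ a b)) ⟩
  oneₚ +ₚ q *ₚ (qint a +ₚ qpow a *ₚ qint b)    ≈⟨ expand oneₚ q (qint a) (qpow a) (qint b) ⟩
  (oneₚ +ₚ q *ₚ qint a) +ₚ (q *ₚ qpow a) *ₚ qint b
    ≈⟨ +ₚ-cong (qint-suc a) (*ₚ-cong (qpow-suc a) ≋-refl) ⟨
  qint (suc a) +ₚ qpow (suc a) *ₚ qint b       ∎
  where
  open ≋-Reasoning
  q = qpow 1
  expand : ∀ o x i p j → o +ₚ x *ₚ (i +ₚ p *ₚ j) ≋ (o +ₚ x *ₚ i) +ₚ (x *ₚ p) *ₚ j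
  expand = solve 5 (λ o x i p j → o :+ x :* (i :+ p :* j) := (o :+ x :* i) :+ (x :* p) :* j) ≋-refl

sumₚ-cong : ∀ N f g → (∀ h → h < N → f h ≋ g h) → sumₚ N f ≋ sumₚ N g
sumₚ-cong zero    f g eq = ≋-refl
sumₚ-cong (suc N) f g eq =
  +ₚ-cong (sumₚ-cong N f g (λ h h<N → eq h (m<n⇒m<1+n h<N))) (eq N (n<1+n N))

sumₚ-vanishing : ∀ N f → (∀ h → h < N → f h ≋ []) → sumₚ N f ≋ []
sumₚ-vanishing zero    f eq = ≋-refl
sumₚ-vanishing (suc N) f eq =
  +ₚ-cong (sumₚ-vanishing N f (λ h h<N → eq h (m<n⇒m<1+n h<N))) (eq N (n<1+n N))

sumₚ-+ : ∀ N f g → sumₚ N (λ h → f h +ₚ g h) ≋ sumₚ N f +ₚ sumₚ N g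
sumₚ-+ zero    f g = ≋-refl
sumₚ-+ (suc N) f g =
  ≋-trans (+ₚ-cong (sumₚ-+ N f g) ≋-refl) (interchange (sumₚ N f) (sumₚ N g) (f N) (g N))
  where
  interchange : ∀ a b c d → (a +ₚ b) +ₚ (c +ₚ d) ≋ (a +ₚ c) +ₚ (b +ₚ d)
  interchange = solve 4 (λ a b c d → (a :+ b) :+ (c :+ d) := (a :+ c) :+ (b :+ d)) ≋-refl

sumₚ-*ˡ : ∀ X N f → X *ₚ sumₚ N f ≋ sumₚ N (λ h → X *ₚ f h)
sumₚ-*ˡ X zero    f = *ₚ-zeroʳ X
sumₚ-*ˡ X (suc N) f =
  ≋-trans (*ₚ-distribˡ X (sumₚ N f) (f N)) (+ₚ-cong (sumₚ-*ˡ X N f) ≋-refl)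

sumₚ-first : ∀ N f → sumₚ (suc N) f ≋ f 0 +ₚ sumₚ N (λ h → f (suc h))
sumₚ-first zero    f = ≋-sym (+ₚ-identityʳ (f 0))
sumₚ-first (suc N) f = ≋-trans (+ₚ-cong (sumₚ-first N f) ≋-refl) (+ₚ-assoc (f 0) _ _)

sumₚ-swap : ∀ N M (f : ℕ → ℕ → Poly) →
  sumₚ N (λ h → sumₚ M (f h)) ≋ sumₚ M (λ c → sumₚ N (λ h → f h c))
sumₚ-swap zero    M f = ≋-sym (sumₚ-vanishing M (λ _ → []) (λ _ _ → ≋-refl))
sumₚ-swap (suc N) M f = ≋-trans (+ₚ-cong (sumₚ-swap N M f) ≋-refl)
  (≋-sym (sumₚ-+ M (λ c → sumₚ N (λ h → f h c)) (f N)))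

≋[]-*ₚ : ∀ {A} B → A ≋ [] → A *ₚ B ≋ []
≋[]-*ₚ B A≋[] = *ₚ-cong A≋[] (≋-refl {B})

*ₚ-≋[] : ∀ A {B} → B ≋ [] → A *ₚ B ≋ []
*ₚ-≋[] A B≋[] = ≋-trans (*ₚ-cong (≋-refl {A}) B≋[]) (*ₚ-zeroʳ A)

data Comparison (m n : ℕ) : Set where
  below : n < m → Comparison m n
  above : ∀ t → n ≡ m + t → Comparison m n

compare : ∀ m n → Comparison m n
compare zero    n       = above n refl
compare (suc m) zero    = below (s≤s z≤n)
compare (suc m) (suc n) with compare m n
... | below n<m   = below (s≤s n<m)
... | above t eq  = above t (cong suc eq)

qfact : ℕ → Poly
qfact zero    = oneₚ
qfact (suc n) = qfact n *ₚ qint (suc n)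

qfact-unitConstant : ∀ n → HasUnitConstant (qfact n)
qfact-unitConstant zero    = refl
qfact-unitConstant (suc n) = unitConstant-*ₚ (qfact n) (qint (suc n)) (qfact-unitConstant n) refl

qbinom : ℕ → ℕ → Poly
qbinom m       zero    = oneₚ
qbinom zero    (suc k) = []
qbinom (suc m) (suc k) = qbinom m k +ₚ qpow (suc k) *ₚ qbinom m (suc k)

qbinom-vanishing : ∀ m k → m < k → qbinom m k ≋ []
qbinom-vanishing zero    (suc k) _         = ≋-refl
qbinom-vanishing (suc m) (suc k) (s≤s m<k) =
  +ₚ-cong (qbinom-vanishing m k m<k)
          (*ₚ-≋[] (qpow (suc k)) (qbinom-vanishing m (suc k) (m<n⇒m<1+n m<k)))

qbinom-diagonal : ∀ k → qbinom k k ≋ oneₚ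
qbinom-diagonal zero    = ≋-refl
qbinom-diagonal (suc k) =
  ≋-trans (+ₚ-cong (qbinom-diagonal k)
                   (*ₚ-≋[] (qpow (suc k)) (qbinom-vanishing k (suc k) (n<1+n k))))
          (+ₚ-identityʳ oneₚ)

qbinom-factorial : ∀ k m → qbinom (k + m) k *ₚ (qfact k *ₚ qfact m) ≋ qfact (k + m)
qbinom-factorial zero    m    = ≋-trans (*ₚ-identityˡ _) (*ₚ-identityˡ _)
qbinom-factorial (suc k) zero =
  subst (λ n → qbinom n (suc k) *ₚ (qfact (suc k) *ₚ oneₚ) ≋ qfact n)
        (sym (+-identityʳ (suc k)))
        (≋-trans (*ₚ-cong (qbinom-diagonal (suc k)) (≋-refl {qfact (suc k) *ₚ oneₚ}))
                 (≋-trans (*ₚ-identityˡ _) (≋-trans (*ₚ-comm _ oneₚ) (*ₚ-identityˡ _))))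
qbinom-factorial (suc k) (suc m) = begin
  (G₁ +ₚ Q *ₚ G₂) *ₚ ((qfact k *ₚ qint (suc k)) *ₚ (qfact m *ₚ qint (suc m)))
    ≈⟨ regroup G₁ G₂ (qfact k) (qfact m) (qint (suc k)) (qint (suc m)) Q ⟩
  (G₁ *ₚ (qfact k *ₚ qfact (suc m))) *ₚ qint (suc k)
    +ₚ Q *ₚ (G₂ *ₚ (qfact (suc k) *ₚ qfact m)) *ₚ qint (suc m)
    ≈⟨ +ₚ-cong (*ₚ-cong (qbinom-factorial k (suc m)) ≋-refl)
               (*ₚ-cong (*ₚ-cong (≋-refl {Q}) second) (≋-refl {qint (suc m)})) ⟩
  F *ₚ qint (suc k) +ₚ Q *ₚ F *ₚ qint (suc m)
    ≈⟨ factor F (qint (suc k)) (qint (suc m)) Q ⟩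
  F *ₚ (qint (suc k) +ₚ Q *ₚ qint (suc m))
    ≈⟨ *ₚ-cong (≋-refl {F}) (qint-+ (suc k) (suc m)) ⟨
  F *ₚ qint (suc k + suc m) ∎
  where
  open ≋-Reasoning
  G₁ = qbinom (k + suc m) k
  G₂ = qbinom (k + suc m) (suc k)
  Q  = qpow (suc k)
  F  = qfact (k + suc m)
  second : G₂ *ₚ (qfact (suc k) *ₚ qfact m) ≋ F
  second = subst (λ n → qbinom n (suc k) *ₚ (qfact (suc k) *ₚ qfact m) ≋ qfact n)
                 (sym (+-suc k m)) (qbinom-factorial (suc k) m)
  regroup : ∀ g₁ g₂ fk fm ik im Q → (g₁ +ₚ Q *ₚ g₂) *ₚ ((fk *ₚ ik) *ₚ (fm *ₚ im))
          ≋ (g₁ *ₚ (fk *ₚ (fm *ₚ im))) *ₚ ik +ₚ Q *ₚ (g₂ *ₚ ((fk *ₚ ik) *ₚ fm)) *ₚ im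
  regroup = solve 7 (λ g₁ g₂ fk fm ik im Q → (g₁ :+ Q :* g₂) :* ((fk :* ik) :* (fm :* im))
          := (g₁ :* (fk :* (fm :* im))) :* ik :+ Q :* (g₂ :* ((fk :* ik) :* fm)) :* im) ≋-refl
  factor : ∀ F ik im Q → F *ₚ ik +ₚ Q *ₚ F *ₚ im ≋ F *ₚ (ik +ₚ Q *ₚ im)
  factor = solve 4 (λ F ik im Q → F :* ik :+ Q :* F :* im := F :* (ik :+ Q :* im)) ≋-refl

cancel-qfacts : ∀ k t {A B} →
  A *ₚ (qfact k *ₚ qfact t) ≋ B *ₚ (qfact k *ₚ qfact t) → A ≋ B
cancel-qfacts k t = *ₚ-cancelʳ (qfact k *ₚ qfact t)
  (unitConstant-*ₚ (qfact k) (qfact t) (qfact-unitConstant k) (qfact-unitConstant t))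

qbinom-absorption : ∀ m k → qint (suc k) *ₚ qbinom (suc m) (suc k) ≋ qint (suc m) *ₚ qbinom m k
qbinom-absorption m k with compare k m
... | below m<k = ≋-trans (*ₚ-≋[] (qint (suc k)) (qbinom-vanishing (suc m) (suc k) (s≤s m<k)))
                          (≋-sym (*ₚ-≋[] (qint (suc m)) (qbinom-vanishing m k m<k)))
... | above t refl = cancel-qfacts k t (begin
  (qint (suc k) *ₚ qbinom (suc k + t) (suc k)) *ₚ (qfact k *ₚ qfact t)
    ≈⟨ regroup (qint (suc k)) (qbinom (suc k + t) (suc k)) (qfact k) (qfact t) ⟩
  qbinom (suc k + t) (suc k) *ₚ (qfact (suc k) *ₚ qfact t)
    ≈⟨ qbinom-factorial (suc k) t ⟩
  qfact (k + t) *ₚ qint (suc k + t)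
    ≈⟨ *ₚ-comm (qfact (k + t)) _ ⟩
  qint (suc k + t) *ₚ qfact (k + t)
    ≈⟨ *ₚ-cong (≋-refl {qint (suc k + t)}) (qbinom-factorial k t) ⟨
  qint (suc k + t) *ₚ (qbinom (k + t) k *ₚ (qfact k *ₚ qfact t))
    ≈⟨ *ₚ-assoc (qint (suc k + t)) (qbinom (k + t) k) (qfact k *ₚ qfact t) ⟨
  (qint (suc k + t) *ₚ qbinom (k + t) k) *ₚ (qfact k *ₚ qfact t) ∎)
  where
  open ≋-Reasoning
  regroup : ∀ i g fk ft → (i *ₚ g) *ₚ (fk *ₚ ft) ≋ g *ₚ ((fk *ₚ i) *ₚ ft)
  regroup = solve 4 (λ i g fk ft → (i :* g) :* (fk :* ft) := g :* ((fk :* i) :* ft)) ≋-refl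

qfalling : ℕ → ℕ → Poly
qfalling m k = prodFrom 0 k (λ j → qint (m ∸ j))

prodFrom-shift : ∀ lo len f → prodFrom (suc lo) len f ≡ prodFrom lo len (λ j → f (suc j))
prodFrom-shift lo zero      f = refl
prodFrom-shift lo (suc len) f = cong (f (suc lo) *ₚ_) (prodFrom-shift (suc lo) len f)

prodFrom-last : ∀ lo len f → prodFrom lo (suc len) f ≋ prodFrom lo len f *ₚ f (lo + len)
prodFrom-last lo zero f =
  subst (λ n → f lo *ₚ oneₚ ≋ oneₚ *ₚ f n) (sym (+-identityʳ lo)) (*ₚ-comm (f lo) oneₚ)
prodFrom-last lo (suc len) f = begin
  f lo *ₚ prodFrom (suc lo) (suc len) f
    ≈⟨ *ₚ-cong (≋-refl {f lo}) (prodFrom-last (suc lo) len f) ⟩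
  f lo *ₚ (prodFrom (suc lo) len f *ₚ f (suc lo + len))
    ≈⟨ *ₚ-assoc (f lo) _ _ ⟨
  (f lo *ₚ prodFrom (suc lo) len f) *ₚ f (suc lo + len)
    ≡⟨ cong (λ n → (f lo *ₚ prodFrom (suc lo) len f) *ₚ f n) (sym (+-suc lo len)) ⟩
  (f lo *ₚ prodFrom (suc lo) len f) *ₚ f (lo + suc len) ∎
  where open ≋-Reasoning

prodFrom-qfact : ∀ k → prodFrom 1 k qint ≋ qfact k
prodFrom-qfact zero    = ≋-refl
prodFrom-qfact (suc k) = ≋-trans (prodFrom-last 1 k qint) (*ₚ-cong (prodFrom-qfact k) ≋-refl)

qbinom-falling : ∀ m k → qbinom m k *ₚ qfact k ≋ qfalling m k
qbinom-falling m       zero    = *ₚ-identityˡ oneₚ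
qbinom-falling zero    (suc k) = ≋-refl
qbinom-falling (suc m) (suc k) = begin
  qbinom (suc m) (suc k) *ₚ (qfact k *ₚ qint (suc k))
    ≈⟨ regroup (qbinom (suc m) (suc k)) (qfact k) (qint (suc k)) ⟩
  (qint (suc k) *ₚ qbinom (suc m) (suc k)) *ₚ qfact k
    ≈⟨ *ₚ-cong (qbinom-absorption m k) ≋-refl ⟩
  (qint (suc m) *ₚ qbinom m k) *ₚ qfact k
    ≈⟨ *ₚ-assoc (qint (suc m)) (qbinom m k) (qfact k) ⟩
  qint (suc m) *ₚ (qbinom m k *ₚ qfact k)
    ≈⟨ *ₚ-cong (≋-refl {qint (suc m)}) (qbinom-falling m k) ⟩
  qint (suc m) *ₚ qfalling m k
    ≡⟨ cong (qint (suc m) *ₚ_) (sym (prodFrom-shift 0 k (λ j → qint (suc m ∸ j)))) ⟩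
  qfalling (suc m) (suc k) ∎
  where
  open ≋-Reasoning
  regroup : ∀ g f i → g *ₚ (f *ₚ i) ≋ (i *ₚ g) *ₚ f
  regroup = solve 3 (λ g f i → g :* (f :* i) := (i :* g) :* f) ≋-refl

isQBinom⇒qbinom : ∀ m k P → IsQBinom m k P → P ≋ qbinom m k
isQBinom⇒qbinom m k P isQBinom =
  *ₚ-cancelʳ (prodFrom 1 k qint) (trans (coeffs (prodFrom-qfact k) 0) (qfact-unitConstant k)) (begin
    P *ₚ prodFrom 1 k qint          ≈⟨ mk isQBinom ⟩
    qfalling m k                    ≈⟨ qbinom-falling m k ⟨
    qbinom m k *ₚ qfact k           ≈⟨ *ₚ-cong (≋-refl {qbinom m k}) (prodFrom-qfact k) ⟨
    qbinom m k *ₚ prodFrom 1 k qint ∎)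
  where open ≋-Reasoning

qbinom-factorial′ : ∀ m t → qbinom (m + t) (suc m) *ₚ (qfact (suc m) *ₚ qfact t) ≋ qfact (m + t) *ₚ qint t
qbinom-factorial′ m zero =
  subst (λ n → qbinom n (suc m) *ₚ (qfact (suc m) *ₚ oneₚ) ≋ qfact n *ₚ [])
        (sym (+-identityʳ m))
        (≋-trans (≋[]-*ₚ (qfact (suc m) *ₚ oneₚ) (qbinom-vanishing m (suc m) (n<1+n m)))
                 (≋-sym (*ₚ-zeroʳ (qfact m))))
qbinom-factorial′ m (suc t) rewrite +-suc m t = begin
  G *ₚ (qfact (suc m) *ₚ (qfact t *ₚ qint (suc t)))
    ≈⟨ regroup G (qfact (suc m)) (qfact t) (qint (suc t)) ⟩
  (G *ₚ (qfact (suc m) *ₚ qfact t)) *ₚ qint (suc t)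
    ≈⟨ *ₚ-cong (qbinom-factorial (suc m) t) ≋-refl ⟩
  qfact (suc m + t) *ₚ qint (suc t) ∎
  where
  open ≋-Reasoning
  G = qbinom (suc (m + t)) (suc m)
  regroup : ∀ g a b i → g *ₚ (a *ₚ (b *ₚ i)) ≋ (g *ₚ (a *ₚ b)) *ₚ i
  regroup = solve 4 (λ g a b i → g :* (a :* (b :* i)) := (g :* (a :* b)) :* i) ≋-refl

qbinom-pascal′ : ∀ m t →
  qbinom (suc m + t) (suc m) ≋ qpow t *ₚ qbinom (m + t) m +ₚ qbinom (m + t) (suc m)
qbinom-pascal′ m t = cancel-qfacts (suc m) t (begin
  qbinom (suc m + t) (suc m) *ₚ (qfact (suc m) *ₚ qfact t)
    ≈⟨ qbinom-factorial (suc m) t ⟩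
  F *ₚ qint (suc (m + t))
    ≡⟨ cong (λ n → F *ₚ qint n) (sym (trans (+-suc t m) (cong suc (+-comm t m)))) ⟩
  F *ₚ qint (t + suc m)
    ≈⟨ *ₚ-cong (≋-refl {F}) (qint-+ t (suc m)) ⟩
  F *ₚ (qint t +ₚ qpow t *ₚ qint (suc m))
    ≈⟨ factor F (qpow t) (qint (suc m)) (qint t) ⟨
  qpow t *ₚ F *ₚ qint (suc m) +ₚ F *ₚ qint t
    ≈⟨ +ₚ-cong (*ₚ-cong (*ₚ-cong (≋-refl {qpow t}) (qbinom-factorial m t)) (≋-refl {qint (suc m)}))
               (qbinom-factorial′ m t) ⟨
  qpow t *ₚ (G₁ *ₚ (qfact m *ₚ qfact t)) *ₚ qint (suc m) +ₚ G₂ *ₚ ((qfact m *ₚ qint (suc m)) *ₚ qfact t)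
    ≈⟨ regroup (qpow t) G₁ G₂ (qfact m) (qint (suc m)) (qfact t) ⟨
  (qpow t *ₚ G₁ +ₚ G₂) *ₚ (qfact (suc m) *ₚ qfact t) ∎)
  where
  open ≋-Reasoning
  F  = qfact (m + t)
  G₁ = qbinom (m + t) m
  G₂ = qbinom (m + t) (suc m)
  regroup : ∀ Q g₁ g₂ fm im ft → (Q *ₚ g₁ +ₚ g₂) *ₚ ((fm *ₚ im) *ₚ ft)
          ≋ Q *ₚ (g₁ *ₚ (fm *ₚ ft)) *ₚ im +ₚ g₂ *ₚ ((fm *ₚ im) *ₚ ft)
  regroup = solve 6 (λ Q g₁ g₂ fm im ft → (Q :* g₁ :+ g₂) :* ((fm :* im) :* ft)
          := Q :* (g₁ :* (fm :* ft)) :* im :+ g₂ :* ((fm :* im) :* ft)) ≋-refl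
  factor : ∀ F Q im it → Q *ₚ F *ₚ im +ₚ F *ₚ it ≋ F *ₚ (it +ₚ Q *ₚ im)
  factor = solve 4 (λ F Q im it → Q :* F :* im :+ F :* it := F :* (it :+ Q :* im)) ≋-refl

qhockey-stick : ∀ n m → sumₚ n (λ h → qpow h *ₚ qbinom h m) ≋ qpow m *ₚ qbinom n (suc m)
qhockey-stick zero    m = ≋-sym (*ₚ-zeroʳ (qpow m))
qhockey-stick (suc n) m = ≋-trans (+ₚ-cong (qhockey-stick n m) ≋-refl) (step n m)
  where
  step : ∀ n m → qpow m *ₚ qbinom n (suc m) +ₚ qpow n *ₚ qbinom n m ≋ qpow m *ₚ qbinom (suc n) (suc m)
  step n m with compare m n
  ... | below n<m = ≋-trans (+ₚ-cong (*ₚ-≋[] (qpow m) (qbinom-vanishing n (suc m) (m<n⇒m<1+n n<m)))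
                                     (*ₚ-≋[] (qpow n) (qbinom-vanishing n m n<m)))
                            (≋-sym (*ₚ-≋[] (qpow m) (qbinom-vanishing (suc n) (suc m) (s≤s n<m))))
  ... | above t refl = begin
    qpow m *ₚ G₂ +ₚ qpow (m + t) *ₚ G₁
      ≈⟨ +ₚ-cong (≋-refl {qpow m *ₚ G₂}) (*ₚ-cong (qpow-+ m t) ≋-refl) ⟩
    qpow m *ₚ G₂ +ₚ (qpow m *ₚ qpow t) *ₚ G₁
      ≈⟨ factor (qpow m) (qpow t) G₁ G₂ ⟩
    qpow m *ₚ (qpow t *ₚ G₁ +ₚ G₂)
      ≈⟨ *ₚ-cong (≋-refl {qpow m}) (qbinom-pascal′ m t) ⟨
    qpow m *ₚ qbinom (suc m + t) (suc m) ∎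
    where
    open ≋-Reasoning
    G₁ = qbinom (m + t) m
    G₂ = qbinom (m + t) (suc m)
    factor : ∀ Qm Qt g₁ g₂ → Qm *ₚ g₂ +ₚ (Qm *ₚ Qt) *ₚ g₁ ≋ Qm *ₚ (Qt *ₚ g₁ +ₚ g₂)
    factor = solve 4 (λ Qm Qt g₁ g₂ → Qm :* g₂ :+ (Qm :* Qt) :* g₁ := Qm :* (Qt :* g₁ :+ g₂)) ≋-refl

vandermondeTerm : ℕ → ℕ → ℕ → ℕ → Poly
vandermondeTerm x y b c = qpow ((x ∸ c) * (b ∸ c)) *ₚ (qbinom x c *ₚ qbinom y (b ∸ c))

-- Exponent bookkeeping for the inductive step, with x = c+1+u, b = c+d.
vandermonde-exponent : ∀ c u d →
  suc (c + d) + (suc c + u ∸ suc c) * (c + d ∸ c) ≡ (suc c + u ∸ c) * (c + d ∸ c) + suc c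
vandermonde-exponent c u d = begin
  suc (c + d) + (suc c + u ∸ suc c) * (c + d ∸ c)
    ≡⟨ cong₂ (λ u′ d′ → suc (c + d) + u′ * d′) (m+n∸m≡n c u) (m+n∸m≡n c d) ⟩
  suc (c + d) + u * d
    ≡⟨ rearrange c d u ⟩
  suc u * d + suc c
    ≡⟨ cong₂ (λ u′ d′ → u′ * d′ + suc c) suc-u (m+n∸m≡n c d) ⟨
  (suc c + u ∸ c) * (c + d ∸ c) + suc c ∎
  where
  open ≡-Reasoning
  rearrange : ∀ c d u → suc (c + d) + u * d ≡ suc u * d + suc c
  rearrange = ℕ-solve-∀
  suc-u : suc c + u ∸ c ≡ suc u
  suc-u = trans (cong (_∸ c) (sym (+-suc c u))) (m+n∸m≡n c (suc u))

-- The term q^((x-c)(b-c)) q^(c+1) [x, c+1] [y, b-c], produced from the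
-- (c+1)-st Vandermonde term for (x+1, b+1) by the q-Pascal rule.
shiftedTerm : ℕ → ℕ → ℕ → ℕ → Poly
shiftedTerm x y b c = qpow ((x ∸ c) * (b ∸ c)) *ₚ (qpow (suc c) *ₚ (qbinom x (suc c) *ₚ qbinom y (b ∸ c)))

vandermondeTerm-pascal : ∀ x y b c →
  vandermondeTerm (suc x) y (suc b) (suc c) ≋ vandermondeTerm x y b c +ₚ shiftedTerm x y b c
vandermondeTerm-pascal x y b c =
  split (qpow ((x ∸ c) * (b ∸ c))) (qbinom x c) (qbinom x (suc c)) (qbinom y (b ∸ c)) (qpow (suc c))
  where
  split : ∀ P g h k R → P *ₚ ((g +ₚ R *ₚ h) *ₚ k) ≋ P *ₚ (g *ₚ k) +ₚ P *ₚ (R *ₚ (h *ₚ k))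
  split = solve 5 (λ P g h k R → P :* ((g :+ R :* h) :* k) := P :* (g :* k) :+ P :* (R :* (h :* k))) ≋-refl

vandermondeTerm-first : ∀ x y b →
  qpow (suc b) *ₚ vandermondeTerm x y (suc b) 0 ≋ vandermondeTerm (suc x) y (suc b) 0
vandermondeTerm-first x y b =
  ≋-trans (≋-sym (*ₚ-assoc (qpow (suc b)) (qpow (x * suc b)) (qbinom x 0 *ₚ qbinom y (suc b))))
          (*ₚ-cong (≋-sym (qpow-+ (suc b) (x * suc b))) ≋-refl)

vandermondeTerm-shift : ∀ x y b c → c < suc b →
  qpow (suc b) *ₚ vandermondeTerm x y (suc b) (suc c) ≋ shiftedTerm x y b c
vandermondeTerm-shift x y b c c≤b with compare (suc c) x | compare c b
... | below x≤c | _ = ≋-trans (*ₚ-≋[] (qpow (suc b)) (*ₚ-≋[] (qpow ((x ∸ suc c) * (b ∸ c))) Y≋[]))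
                              (≋-sym (*ₚ-≋[] (qpow ((x ∸ c) * (b ∸ c))) (*ₚ-≋[] (qpow (suc c)) Y≋[])))
  where
  Y≋[] : qbinom x (suc c) *ₚ qbinom y (b ∸ c) ≋ []
  Y≋[] = ≋[]-*ₚ (qbinom y (b ∸ c)) (qbinom-vanishing x (suc c) x≤c)
... | above u refl | below b<c = ⊥-elim (<⇒≱ b<c (≤-pred c≤b))
... | above u refl | above d refl = begin
  qpow (suc (c + d)) *ₚ (qpow e₁ *ₚ Y)  ≈⟨ *ₚ-assoc (qpow (suc (c + d))) (qpow e₁) Y ⟨
  (qpow (suc (c + d)) *ₚ qpow e₁) *ₚ Y  ≈⟨ *ₚ-cong (qpow-+ (suc (c + d)) e₁) (≋-refl {Y}) ⟨
  qpow (suc (c + d) + e₁) *ₚ Y          ≡⟨ cong (λ e → qpow e *ₚ Y) (vandermonde-exponent c u d) ⟩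
  qpow (e₂ + suc c) *ₚ Y                ≈⟨ *ₚ-cong (qpow-+ e₂ (suc c)) (≋-refl {Y}) ⟩
  (qpow e₂ *ₚ qpow (suc c)) *ₚ Y        ≈⟨ *ₚ-assoc (qpow e₂) (qpow (suc c)) Y ⟩
  qpow e₂ *ₚ (qpow (suc c) *ₚ Y)        ∎
  where
  open ≋-Reasoning
  e₁ = (suc c + u ∸ suc c) * (c + d ∸ c)
  e₂ = (suc c + u ∸ c) * (c + d ∸ c)
  Y  = qbinom (suc c + u) (suc c) *ₚ qbinom y (c + d ∸ c)

qvandermonde : ∀ x y b → qbinom (x + y) b ≋ sumₚ (suc b) (vandermondeTerm x y b)
qvandermonde zero    y b = ≋-sym (begin
  sumₚ (suc b) (vandermondeTerm 0 y b)
    ≈⟨ sumₚ-first b (vandermondeTerm 0 y b) ⟩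
  vandermondeTerm 0 y b 0 +ₚ sumₚ b (λ c → vandermondeTerm 0 y b (suc c))
    ≈⟨ +ₚ-cong (≋-trans (*ₚ-identityˡ _) (*ₚ-identityˡ _))
               (sumₚ-vanishing b _ (λ c _ → *ₚ-zeroʳ (qpow ((0 ∸ suc c) * (b ∸ suc c))))) ⟩
  qbinom y b +ₚ []
    ≈⟨ +ₚ-identityʳ (qbinom y b) ⟩
  qbinom y b ∎)
  where open ≋-Reasoning
qvandermonde (suc x) y zero    =
  ≋-sym (≋-trans (*ₚ-cong (≡⇒≋ (cong qpow (*-zeroʳ (suc x)))) (*ₚ-identityˡ oneₚ)) (*ₚ-identityˡ oneₚ))
qvandermonde (suc x) y (suc b) = begin
  qbinom (x + y) b +ₚ Q *ₚ qbinom (x + y) (suc b)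
    ≈⟨ +ₚ-cong (qvandermonde x y b) (*ₚ-cong (≋-refl {Q}) (qvandermonde x y (suc b))) ⟩
  S +ₚ Q *ₚ sumₚ (suc (suc b)) T
    ≈⟨ +ₚ-cong (≋-refl {S}) (*ₚ-cong (≋-refl {Q}) (sumₚ-first (suc b) T)) ⟩
  S +ₚ Q *ₚ (T 0 +ₚ sumₚ (suc b) (λ c → T (suc c)))
    ≈⟨ +ₚ-cong (≋-refl {S}) (*ₚ-distribˡ Q (T 0) _) ⟩
  S +ₚ (Q *ₚ T 0 +ₚ Q *ₚ sumₚ (suc b) (λ c → T (suc c)))
    ≈⟨ +ₚ-cong (≋-refl {S}) (+ₚ-cong (≋-refl {Q *ₚ T 0})
         (≋-trans (sumₚ-*ˡ Q (suc b) (λ c → T (suc c))) (sumₚ-cong (suc b) _ W (vandermondeTerm-shift x y b)))) ⟩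
  S +ₚ (Q *ₚ T 0 +ₚ sumₚ (suc b) W)
    ≈⟨ reorder S (Q *ₚ T 0) (sumₚ (suc b) W) ⟩
  Q *ₚ T 0 +ₚ (S +ₚ sumₚ (suc b) W)
    ≈⟨ +ₚ-cong (vandermondeTerm-first x y b) (≋-sym (≋-trans
         (sumₚ-cong (suc b) _ _ (λ c _ → vandermondeTerm-pascal x y b c)) (sumₚ-+ (suc b) (vandermondeTerm x y b) W))) ⟩
  T′ 0 +ₚ sumₚ (suc b) (λ c → T′ (suc c))
    ≈⟨ sumₚ-first (suc b) T′ ⟨
  sumₚ (suc (suc b)) T′ ∎
  where
  open ≋-Reasoning
  Q = qpow (suc b)
  S = sumₚ (suc b) (vandermondeTerm x y b)
  T T′ W : ℕ → Poly
  T  = vandermondeTerm x y (suc b)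
  T′ = vandermondeTerm (suc x) y (suc b)
  W  = shiftedTerm x y b
  reorder : ∀ s a t → s +ₚ (a +ₚ t) ≋ a +ₚ (s +ₚ t)
  reorder = solve 3 (λ s a t → s :+ (a :+ t) := a :+ (s :+ t)) ≋-refl

-- Trinomial revision [k+y, k] [y, i] = [k+y, k+i] [k+i, k]: both sides
-- are [k+y]! / ([k]! [i]! [y-i]!).
qbinom-trinomial : ∀ k y i →
  qbinom (k + y) k *ₚ qbinom y i ≋ qbinom (k + y) (k + i) *ₚ qbinom (k + i) k
qbinom-trinomial k y i with compare i y
... | below y<i = ≋-trans (*ₚ-≋[] (qbinom (k + y) k) (qbinom-vanishing y i y<i))
                          (≋-sym (≋[]-*ₚ (qbinom (k + i) k) (qbinom-vanishing (k + y) (k + i) (+-monoʳ-< k y<i))))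
... | above s refl = *ₚ-cancelʳ F F-unitConstant (begin
  (qbinom (k + (i + s)) k *ₚ qbinom (i + s) i) *ₚ F
    ≈⟨ regroupˡ (qbinom (k + (i + s)) k) (qbinom (i + s) i) (qfact k) (qfact i) (qfact s) ⟩
  qbinom (k + (i + s)) k *ₚ (qfact k *ₚ (qbinom (i + s) i *ₚ (qfact i *ₚ qfact s)))
    ≈⟨ *ₚ-cong (≋-refl {qbinom (k + (i + s)) k}) (*ₚ-cong (≋-refl {qfact k}) (qbinom-factorial i s)) ⟩
  qbinom (k + (i + s)) k *ₚ (qfact k *ₚ qfact (i + s))
    ≈⟨ qbinom-factorial k (i + s) ⟩
  qfact (k + (i + s))
    ≈⟨ subst (λ n → qbinom n (k + i) *ₚ (qfact (k + i) *ₚ qfact s) ≋ qfact n)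
             (+-assoc k i s) (qbinom-factorial (k + i) s) ⟨
  qbinom (k + (i + s)) (k + i) *ₚ (qfact (k + i) *ₚ qfact s)
    ≈⟨ *ₚ-cong (≋-refl {qbinom (k + (i + s)) (k + i)}) (*ₚ-cong (qbinom-factorial k i) (≋-refl {qfact s})) ⟨
  qbinom (k + (i + s)) (k + i) *ₚ ((qbinom (k + i) k *ₚ (qfact k *ₚ qfact i)) *ₚ qfact s)
    ≈⟨ regroupʳ (qbinom (k + (i + s)) (k + i)) (qbinom (k + i) k) (qfact k) (qfact i) (qfact s) ⟨
  (qbinom (k + (i + s)) (k + i) *ₚ qbinom (k + i) k) *ₚ F ∎)
  where
  open ≋-Reasoning
  F = qfact k *ₚ (qfact i *ₚ qfact s)
  F-unitConstant : HasUnitConstant F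
  F-unitConstant = unitConstant-*ₚ (qfact k) (qfact i *ₚ qfact s) (qfact-unitConstant k)
    (unitConstant-*ₚ (qfact i) (qfact s) (qfact-unitConstant i) (qfact-unitConstant s))
  regroupˡ : ∀ g₁ g₂ fk fi fs → (g₁ *ₚ g₂) *ₚ (fk *ₚ (fi *ₚ fs)) ≋ g₁ *ₚ (fk *ₚ (g₂ *ₚ (fi *ₚ fs)))
  regroupˡ = solve 5 (λ g₁ g₂ fk fi fs → (g₁ :* g₂) :* (fk :* (fi :* fs)) := g₁ :* (fk :* (g₂ :* (fi :* fs)))) ≋-refl
  regroupʳ : ∀ g₁ g₂ fk fi fs → (g₁ *ₚ g₂) *ₚ (fk *ₚ (fi *ₚ fs)) ≋ g₁ *ₚ ((g₂ *ₚ (fk *ₚ fi)) *ₚ fs)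
  regroupʳ = solve 5 (λ g₁ g₂ fk fi fs → (g₁ :* g₂) :* (fk :* (fi :* fs)) := g₁ :* ((g₂ :* (fk :* fi)) :* fs)) ≋-refl

-- The coefficient of [h, k+l-c] in the expansion of [h, k] [h, l].
productCoeff : ℕ → ℕ → ℕ → Poly
productCoeff k l c = qpow ((k ∸ c) * (l ∸ c)) *ₚ (qbinom k c *ₚ qbinom (k + (l ∸ c)) k)

-- Linearisation of a product of q-binomials with the same top entry:
--   [h, k] [h, l] = ∑_{c≤l} q^((k-c)(l-c)) [k, c] [k+l-c, k] [h, k+l-c],
-- from Vandermonde applied to [h, l] followed by trinomial revision.
qbinom-product : ∀ k l h →
  qbinom h k *ₚ qbinom h l ≋ sumₚ (suc l) (λ c → productCoeff k l c *ₚ qbinom h (k + (l ∸ c)))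
qbinom-product k l h with compare k h
... | below h<k = ≋-trans (≋[]-*ₚ (qbinom h l) (qbinom-vanishing h k h<k))
  (≋-sym (sumₚ-vanishing (suc l) _ λ c _ →
    *ₚ-≋[] (productCoeff k l c) (qbinom-vanishing h (k + (l ∸ c)) (<-≤-trans h<k (m≤m+n k (l ∸ c))))))
... | above y refl = begin
  qbinom (k + y) k *ₚ qbinom (k + y) l
    ≈⟨ *ₚ-cong (≋-refl {qbinom (k + y) k}) (qvandermonde k y l) ⟩
  qbinom (k + y) k *ₚ sumₚ (suc l) (vandermondeTerm k y l)
    ≈⟨ sumₚ-*ˡ (qbinom (k + y) k) (suc l) (vandermondeTerm k y l) ⟩
  sumₚ (suc l) (λ c → qbinom (k + y) k *ₚ vandermondeTerm k y l c)
    ≈⟨ sumₚ-cong (suc l) _ _ (λ c _ → term c) ⟩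
  sumₚ (suc l) (λ c → productCoeff k l c *ₚ qbinom (k + y) (k + (l ∸ c))) ∎
  where
  open ≋-Reasoning
  regroupˡ : ∀ g Q a b → g *ₚ (Q *ₚ (a *ₚ b)) ≋ Q *ₚ (a *ₚ (g *ₚ b))
  regroupˡ = solve 4 (λ g Q a b → g :* (Q :* (a :* b)) := Q :* (a :* (g :* b))) ≋-refl
  regroupʳ : ∀ Q a c d → Q *ₚ (a *ₚ (c *ₚ d)) ≋ (Q *ₚ (a *ₚ d)) *ₚ c
  regroupʳ = solve 4 (λ Q a c d → Q :* (a :* (c :* d)) := (Q :* (a :* d)) :* c) ≋-refl
  term : ∀ c → qbinom (k + y) k *ₚ vandermondeTerm k y l c ≋ productCoeff k l c *ₚ qbinom (k + y) (k + (l ∸ c))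
  term c = begin
    qbinom (k + y) k *ₚ (Q *ₚ (qbinom k c *ₚ qbinom y (l ∸ c)))
      ≈⟨ regroupˡ (qbinom (k + y) k) Q (qbinom k c) (qbinom y (l ∸ c)) ⟩
    Q *ₚ (qbinom k c *ₚ (qbinom (k + y) k *ₚ qbinom y (l ∸ c)))
      ≈⟨ *ₚ-cong (≋-refl {Q}) (*ₚ-cong (≋-refl {qbinom k c}) (qbinom-trinomial k y (l ∸ c))) ⟩
    Q *ₚ (qbinom k c *ₚ (qbinom (k + y) (k + (l ∸ c)) *ₚ qbinom (k + (l ∸ c)) k))
      ≈⟨ regroupʳ Q (qbinom k c) (qbinom (k + y) (k + (l ∸ c))) (qbinom (k + (l ∸ c)) k) ⟩
    productCoeff k l c *ₚ qbinom (k + y) (k + (l ∸ c)) ∎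
    where Q = qpow ((k ∸ c) * (l ∸ c))

weightedSum-product : ∀ n k l →
  sumₚ n (λ h → qpow h *ₚ (qbinom h k *ₚ qbinom h l))
  ≋ sumₚ (suc l) (λ c → productCoeff k l c *ₚ (qpow (k + (l ∸ c)) *ₚ qbinom n (suc (k + (l ∸ c)))))
weightedSum-product n k l = begin
  sumₚ n (λ h → qpow h *ₚ (qbinom h k *ₚ qbinom h l))
    ≈⟨ sumₚ-cong n _ _ (λ h _ → *ₚ-cong (≋-refl {qpow h}) (qbinom-product k l h)) ⟩
  sumₚ n (λ h → qpow h *ₚ sumₚ (suc l) (λ c → P c *ₚ qbinom h (m c)))
    ≈⟨ sumₚ-cong n _ _ (λ h _ → ≋-trans (sumₚ-*ˡ (qpow h) (suc l) _)
                                        (sumₚ-cong (suc l) _ _ (λ c _ → swap (qpow h) (P c) _))) ⟩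
  sumₚ n (λ h → sumₚ (suc l) (λ c → P c *ₚ (qpow h *ₚ qbinom h (m c))))
    ≈⟨ sumₚ-swap n (suc l) (λ h c → P c *ₚ (qpow h *ₚ qbinom h (m c))) ⟩
  sumₚ (suc l) (λ c → sumₚ n (λ h → P c *ₚ (qpow h *ₚ qbinom h (m c))))
    ≈⟨ sumₚ-cong (suc l) _ _ (λ c _ → ≋-trans (≋-sym (sumₚ-*ˡ (P c) n _))
                                             (*ₚ-cong (≋-refl {P c}) (qhockey-stick n (m c)))) ⟩
  sumₚ (suc l) (λ c → P c *ₚ (qpow (m c) *ₚ qbinom n (suc (m c)))) ∎
  where
  open ≋-Reasoning
  P : ℕ → Poly
  P = productCoeff k l
  m : ℕ → ℕ
  m c = k + (l ∸ c)
  swap : ∀ a b g → a *ₚ (b *ₚ g) ≋ b *ₚ (a *ₚ g)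
  swap = solve 3 (λ a b g → a :* (b :* g) := b :* (a :* g)) ≋-refl

-- With a = c+r and b = a+r (so b = 2a-c):
--   [2a+1] [2a, a] [a, c] = [b+1] [2a+1, c] [b, a],
-- since both sides equal [2a+1]! / ([a]! [c]! [r]!).
qbinom-central : ∀ c r → let a = c + r ; b = c + r + r in
  qint (suc (a + a)) *ₚ qbinom (a + a) a *ₚ qbinom a c
  ≋ qint (suc b) *ₚ qbinom (suc (a + a)) c *ₚ qbinom b a
qbinom-central c r = *ₚ-cancelʳ F F-unitConstant (begin
  qint (suc (a + a)) *ₚ qbinom (a + a) a *ₚ qbinom a c *ₚ F
    ≈⟨ regroupˡ (qint (suc (a + a))) (qbinom (a + a) a) (qbinom a c) (qfact c) (qfact r) (qfact a) (qfact b) ⟩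
  qbinom (a + a) a *ₚ (qfact a *ₚ (qbinom a c *ₚ (qfact c *ₚ qfact r))) *ₚ qint (suc (a + a)) *ₚ qfact b
    ≈⟨ *ₚ-cong (*ₚ-cong (*ₚ-cong (≋-refl {qbinom (a + a) a}) (*ₚ-cong (≋-refl {qfact a}) (qbinom-factorial c r)))
                        (≋-refl {qint (suc (a + a))}))
               (≋-refl {qfact b}) ⟩
  qbinom (a + a) a *ₚ (qfact a *ₚ qfact a) *ₚ qint (suc (a + a)) *ₚ qfact b
    ≈⟨ *ₚ-cong (*ₚ-cong (qbinom-factorial a a) (≋-refl {qint (suc (a + a))})) (≋-refl {qfact b}) ⟩
  qfact (suc (a + a)) *ₚ qfact b
    ≈⟨ *ₚ-cong first (qbinom-factorial a r) ⟨
  (qbinom (suc (a + a)) c *ₚ (qfact c *ₚ qfact (suc b))) *ₚ (qbinom b a *ₚ (qfact a *ₚ qfact r))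
    ≈⟨ regroupʳ (qint (suc b)) (qbinom (suc (a + a)) c) (qbinom b a) (qfact c) (qfact r) (qfact a) (qfact b) ⟨
  qint (suc b) *ₚ qbinom (suc (a + a)) c *ₚ qbinom b a *ₚ F ∎)
  where
  open ≋-Reasoning
  a = c + r
  b = c + r + r
  F = qfact c *ₚ qfact r *ₚ qfact a *ₚ qfact b
  F-unitConstant : HasUnitConstant F
  F-unitConstant =
    unitConstant-*ₚ (qfact c *ₚ qfact r *ₚ qfact a) (qfact b)
      (unitConstant-*ₚ (qfact c *ₚ qfact r) (qfact a)
        (unitConstant-*ₚ (qfact c) (qfact r) (qfact-unitConstant c) (qfact-unitConstant r))
        (qfact-unitConstant a))
      (qfact-unitConstant b)
  top-entry : ∀ c r → c + suc (c + r + r) ≡ suc (c + r + (c + r))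
  top-entry = ℕ-solve-∀
  top : c + suc b ≡ suc (a + a)
  top = top-entry c r
  first : qbinom (suc (a + a)) c *ₚ (qfact c *ₚ qfact (suc b)) ≋ qfact (suc (a + a))
  first = subst (λ n → qbinom n c *ₚ (qfact c *ₚ qfact (suc b)) ≋ qfact n) top
                (qbinom-factorial c (suc b))
  regroupˡ : ∀ i g₁ g₂ fc fr fa fb → i *ₚ g₁ *ₚ g₂ *ₚ (fc *ₚ fr *ₚ fa *ₚ fb)
           ≋ g₁ *ₚ (fa *ₚ (g₂ *ₚ (fc *ₚ fr))) *ₚ i *ₚ fb
  regroupˡ = solve 7 (λ i g₁ g₂ fc fr fa fb → i :* g₁ :* g₂ :* (fc :* fr :* fa :* fb)
           := g₁ :* (fa :* (g₂ :* (fc :* fr))) :* i :* fb) ≋-refl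
  regroupʳ : ∀ i g₁ g₂ fc fr fa fb → i *ₚ g₁ *ₚ g₂ *ₚ (fc *ₚ fr *ₚ fa *ₚ fb)
           ≋ (g₁ *ₚ (fc *ₚ (fb *ₚ i))) *ₚ (g₂ *ₚ (fa *ₚ fr))
  regroupʳ = solve 7 (λ i g₁ g₂ fc fr fa fb → i :* g₁ :* g₂ :* (fc :* fr :* fa :* fb)
           := (g₁ :* (fc :* (fb :* i))) :* (g₂ :* (fa :* fr))) ≋-refl

two-k+1 : ∀ k → 2 * k + 1 ≡ suc (k + k)
two-k+1 = ℕ-solve-∀

two-k : ∀ k → 2 * k ≡ k + k
two-k = ℕ-solve-∀

∣ₚ-resp : ∀ {B A A′} → A ≋ A′ → B ∣ₚ A → B ∣ₚ A′
∣ₚ-resp (mk eq) (K , A≈KB) = K , λ i → trans (sym (eq i)) (A≈KB i)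

∣ₚ-*ˡ : ∀ {B A} X → B ∣ₚ A → B ∣ₚ X *ₚ A
∣ₚ-*ˡ {B} X (K , A≈KB) =
  X *ₚ K , coeffs (≋-trans (*ₚ-cong (≋-refl {X}) (mk A≈KB)) (≋-sym (*ₚ-assoc X K B)))

∣ₚ-+ : ∀ {B A₁ A₂} → B ∣ₚ A₁ → B ∣ₚ A₂ → B ∣ₚ A₁ +ₚ A₂
∣ₚ-+ {B} {A₁} {A₂} (K₁ , eq₁) (K₂ , eq₂) = K₁ +ₚ K₂ ,
  coeffs (≋-trans (+ₚ-cong {A₁} {K₁ *ₚ B} {A₂} (mk eq₁) (mk eq₂)) (≋-sym (*ₚ-distribʳ B K₁ K₂)))

∣ₚ-sum : ∀ {B} N f → (∀ h → h < N → B ∣ₚ f h) → B ∣ₚ sumₚ N f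
∣ₚ-sum zero    f _ = [] , λ _ → refl
∣ₚ-sum (suc N) f d = ∣ₚ-+ {A₁ = sumₚ N f} (∣ₚ-sum N f (λ h h<N → d h (m<n⇒m<1+n h<N))) (d N (n<1+n N))

-- [n] divides [b+1] [n, b+1]: this is the absorption identity.
qint-∣ₚ-absorbed : ∀ n b → qint n ∣ₚ qint (suc b) *ₚ qbinom n (suc b)
qint-∣ₚ-absorbed zero    b = [] , coeffs (*ₚ-zeroʳ (qint (suc b)))
qint-∣ₚ-absorbed (suc n) b =
  qbinom n b , coeffs (≋-trans (qbinom-absorption n b) (*ₚ-comm (qint (suc n)) (qbinom n b)))

-- For c ≤ k and m = 2k-c, [m+1] divides [2k+1] [2k, k] · productCoeff k k c;
-- this is the central identity with a = k, r = k-c.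
central-factor : ∀ k c → c < suc k →
  qint (suc (k + (k ∸ c))) ∣ₚ qint (2 * k + 1) *ₚ qbinom (2 * k) k *ₚ productCoeff k k c
central-factor k c c≤k with compare c k
... | below k<c    = ⊥-elim (<⇒≱ k<c (≤-pred c≤k))
... | above r refl rewrite m+n∸m≡n c r | two-k+1 (c + r) | two-k (c + r) =
  qbinom (suc (a + a)) c *ₚ qbinom b a *ₚ (qpow (r * r) *ₚ qbinom b a) , coeffs (begin
    qint (suc (a + a)) *ₚ qbinom (a + a) a *ₚ (qpow (r * r) *ₚ (qbinom a c *ₚ qbinom b a))
      ≈⟨ regroupˡ (qint (suc (a + a))) (qbinom (a + a) a) (qpow (r * r)) (qbinom a c) (qbinom b a) ⟩
    qint (suc (a + a)) *ₚ qbinom (a + a) a *ₚ qbinom a c *ₚ (qpow (r * r) *ₚ qbinom b a)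
      ≈⟨ *ₚ-cong (qbinom-central c r) (≋-refl {qpow (r * r) *ₚ qbinom b a}) ⟩
    qint (suc b) *ₚ qbinom (suc (a + a)) c *ₚ qbinom b a *ₚ (qpow (r * r) *ₚ qbinom b a)
      ≈⟨ regroupʳ (qint (suc b)) (qbinom (suc (a + a)) c) (qbinom b a) (qpow (r * r) *ₚ qbinom b a) ⟩
    qbinom (suc (a + a)) c *ₚ qbinom b a *ₚ (qpow (r * r) *ₚ qbinom b a) *ₚ qint (suc b) ∎)
  where
  open ≋-Reasoning
  a = c + r
  b = c + r + r
  regroupˡ : ∀ i g Q x y → i *ₚ g *ₚ (Q *ₚ (x *ₚ y)) ≋ i *ₚ g *ₚ x *ₚ (Q *ₚ y)
  regroupˡ = solve 5 (λ i g Q x y → i :* g :* (Q :* (x :* y)) := i :* g :* x :* (Q :* y)) ≋-refl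
  regroupʳ : ∀ i g x z → i *ₚ g *ₚ x *ₚ z ≋ g *ₚ x *ₚ z *ₚ i
  regroupʳ = solve 4 (λ i g x z → i :* g :* x :* z := g :* x :* z :* i) ≋-refl

centralSum : ℕ → ℕ → Poly
centralSum n k =
  qint (2 * k + 1) *ₚ qbinom (2 * k) k *ₚ sumₚ n (λ h → qpow h *ₚ (qbinom h k *ₚ qbinom h k))

qint-∣ₚ-central-sum : ∀ n k → qint n ∣ₚ centralSum n k
qint-∣ₚ-central-sum n k = ∣ₚ-resp (≋-sym expand) (∣ₚ-sum (suc k) _ term)
  where
  open ≋-Reasoning
  A = qint (2 * k + 1) *ₚ qbinom (2 * k) k
  m : ℕ → ℕ
  m c = k + (k ∸ c)
  T : ℕ → Poly
  T c = productCoeff k k c *ₚ (qpow (m c) *ₚ qbinom n (suc (m c)))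
  expand : centralSum n k ≋ sumₚ (suc k) (λ c → A *ₚ T c)
  expand = ≋-trans (*ₚ-cong (≋-refl {A}) (weightedSum-product n k k)) (sumₚ-*ˡ A (suc k) T)
  regroup : ∀ A P K I Q G → A *ₚ P ≋ K *ₚ I → A *ₚ (P *ₚ (Q *ₚ G)) ≋ (K *ₚ Q) *ₚ (I *ₚ G)
  regroup A P K I Q G AP≋KI = begin
    A *ₚ (P *ₚ (Q *ₚ G))  ≈⟨ *ₚ-assoc A P (Q *ₚ G) ⟨
    (A *ₚ P) *ₚ (Q *ₚ G)  ≈⟨ *ₚ-cong AP≋KI (≋-refl {Q *ₚ G}) ⟩
    (K *ₚ I) *ₚ (Q *ₚ G)  ≈⟨ swap K I Q G ⟩
    (K *ₚ Q) *ₚ (I *ₚ G)  ∎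
    where
    swap : ∀ K I Q G → (K *ₚ I) *ₚ (Q *ₚ G) ≋ (K *ₚ Q) *ₚ (I *ₚ G)
    swap = solve 4 (λ K I Q G → (K :* I) :* (Q :* G) := (K :* Q) :* (I :* G)) ≋-refl
  term : ∀ c → c < suc k → qint n ∣ₚ A *ₚ T c
  term c c≤k with central-factor k c c≤k
  ... | K , AP≈KI = ∣ₚ-resp
    (≋-sym (regroup A (productCoeff k k c) K (qint (suc (m c))) (qpow (m c)) (qbinom n (suc (m c))) (mk AP≈KI)))
    (∣ₚ-*ˡ (K *ₚ qpow (m c)) (qint-∣ₚ-absorbed n (m c)))

eval₁ : Poly → ℤ
eval₁ []       = 0ℤ
eval₁ (a ∷ as) = a +ℤ eval₁ as

eval₁-vanishing : ∀ A → (∀ i → coeff A i ≡ 0ℤ) → eval₁ A ≡ 0ℤ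
eval₁-vanishing []       z = refl
eval₁-vanishing (a ∷ as) z = cong₂ _+ℤ_ (z 0) (eval₁-vanishing as (λ i → z (suc i)))

eval₁-cong : ∀ A B → A ≈ₚ B → eval₁ A ≡ eval₁ B
eval₁-cong []       B        eq = sym (eval₁-vanishing B (λ i → sym (eq i)))
eval₁-cong (a ∷ as) []       eq = eval₁-vanishing (a ∷ as) eq
eval₁-cong (a ∷ as) (b ∷ bs) eq = cong₂ _+ℤ_ (eq 0) (eval₁-cong as bs (λ i → eq (suc i)))

eval₁-+ : ∀ A B → eval₁ (A +ₚ B) ≡ eval₁ A +ℤ eval₁ B
eval₁-+ []       B        = sym (ℤP.+-identityˡ _)
eval₁-+ (a ∷ as) []       = sym (ℤP.+-identityʳ _)
eval₁-+ (a ∷ as) (b ∷ bs) = trans (cong (a +ℤ b +ℤ_) (eval₁-+ as bs)) (interchange a b (eval₁ as) (eval₁ bs))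
  where
  interchange : ∀ a b x y → a +ℤ b +ℤ (x +ℤ y) ≡ a +ℤ x +ℤ (b +ℤ y)
  interchange = solve-∀

eval₁-scale : ∀ c A → eval₁ (scaleₚ c A) ≡ c *ℤ eval₁ A
eval₁-scale c []       = sym (ℤP.*-zeroʳ c)
eval₁-scale c (a ∷ as) =
  trans (cong (c *ℤ a +ℤ_) (eval₁-scale c as)) (sym (ℤP.*-distribˡ-+ c a (eval₁ as)))

eval₁-* : ∀ A B → eval₁ (A *ₚ B) ≡ eval₁ A *ℤ eval₁ B
eval₁-* []       B = refl
eval₁-* (a ∷ as) B = begin
  eval₁ (scaleₚ a B +ₚ shift (as *ₚ B))      ≡⟨ eval₁-+ (scaleₚ a B) (shift (as *ₚ B)) ⟩
  eval₁ (scaleₚ a B) +ℤ (0ℤ +ℤ eval₁ (as *ₚ B)) ≡⟨ cong₂ _+ℤ_ (eval₁-scale a B) (cong (0ℤ +ℤ_) (eval₁-* as B)) ⟩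
  a *ℤ eval₁ B +ℤ (0ℤ +ℤ eval₁ as *ℤ eval₁ B) ≡⟨ collect a (eval₁ as) (eval₁ B) ⟩
  (a +ℤ eval₁ as) *ℤ eval₁ B                  ∎
  where
  open ≡-Reasoning
  collect : ∀ a x y → a *ℤ y +ℤ (0ℤ +ℤ x *ℤ y) ≡ (a +ℤ x) *ℤ y
  collect = solve-∀

eval₁-qint : ∀ n → eval₁ (qint n) ≡ + n
eval₁-qint zero    = refl
eval₁-qint (suc n) = cong (1ℤ +ℤ_) (eval₁-qint n)

eval₁-qpow : ∀ n → eval₁ (qpow n) ≡ 1ℤ
eval₁-qpow zero    = refl
eval₁-qpow (suc n) = trans (ℤP.+-identityˡ _) (eval₁-qpow n)

eval₁-qbinom : ∀ m k → eval₁ (qbinom m k) ≡ + (m C k)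
eval₁-qbinom m       zero    = refl
eval₁-qbinom zero    (suc k) = refl
eval₁-qbinom (suc m) (suc k) = begin
  eval₁ (qbinom m k +ₚ qpow (suc k) *ₚ qbinom m (suc k))
    ≡⟨ eval₁-+ (qbinom m k) (qpow (suc k) *ₚ qbinom m (suc k)) ⟩
  eval₁ (qbinom m k) +ℤ eval₁ (qpow (suc k) *ₚ qbinom m (suc k))
    ≡⟨ cong (eval₁ (qbinom m k) +ℤ_) (eval₁-* (qpow (suc k)) (qbinom m (suc k))) ⟩
  eval₁ (qbinom m k) +ℤ eval₁ (qpow (suc k)) *ℤ eval₁ (qbinom m (suc k))
    ≡⟨ cong₂ (λ x y → x +ℤ y *ℤ eval₁ (qbinom m (suc k))) (eval₁-qbinom m k) (eval₁-qpow (suc k)) ⟩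
  + (m C k) +ℤ 1ℤ *ℤ eval₁ (qbinom m (suc k))
    ≡⟨ cong (λ x → + (m C k) +ℤ x) (trans (ℤP.*-identityˡ _) (eval₁-qbinom m (suc k))) ⟩
  + (m C k) +ℤ + (m C suc k)
    ≡⟨ ℤP.pos-+ (m C k) (m C suc k) ⟨
  + (m C k + m C suc k)
    ≡⟨ cong +_ (nCk+nC[k+1]≡[n+1]C[k+1] m k) ⟩
  + (suc m C suc k) ∎
  where open ≡-Reasoning

eval₁-sum : ∀ n f g → (∀ h → eval₁ (f h) ≡ + g h) → eval₁ (sumₚ n f) ≡ + sumℕ n g
eval₁-sum zero    f g eq = refl
eval₁-sum (suc n) f g eq = trans (eval₁-+ (sumₚ n f) (f n))
  (trans (cong₂ _+ℤ_ (eval₁-sum n f g eq) (eq n)) (sym (ℤP.pos-+ (sumℕ n g) (g n))))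

eval₁-central-sum : ∀ n k →
  eval₁ (centralSum n k) ≡ + ((2 * k + 1) * ((2 * k) C k) * sumℕ n (λ h → (h C k) * (h C k)))
eval₁-central-sum n k = begin
  eval₁ (I *ₚ D *ₚ S)
    ≡⟨ trans (eval₁-* (I *ₚ D) S) (cong (_*ℤ eval₁ S) (eval₁-* I D)) ⟩
  eval₁ I *ℤ eval₁ D *ℤ eval₁ S
    ≡⟨ cong₂ _*ℤ_ (cong₂ _*ℤ_ (eval₁-qint (2 * k + 1)) (eval₁-qbinom (2 * k) k)) (eval₁-sum n _ _ term) ⟩
  + (2 * k + 1) *ℤ + ((2 * k) C k) *ℤ + sumℕ n (λ h → (h C k) * (h C k))
    ≡⟨ trans (ℤP.pos-* ((2 * k + 1) * ((2 * k) C k)) _) (cong (_*ℤ + sumℕ n (λ h → (h C k) * (h C k))) (ℤP.pos-* (2 * k + 1) _)) ⟨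
  + ((2 * k + 1) * ((2 * k) C k) * sumℕ n (λ h → (h C k) * (h C k))) ∎
  where
  open ≡-Reasoning
  I = qint (2 * k + 1)
  D = qbinom (2 * k) k
  S = sumₚ n (λ h → qpow h *ₚ (qbinom h k *ₚ qbinom h k))
  term : ∀ h → eval₁ (qpow h *ₚ (qbinom h k *ₚ qbinom h k)) ≡ + ((h C k) * (h C k))
  term h = begin
    eval₁ (qpow h *ₚ (qbinom h k *ₚ qbinom h k))
      ≡⟨ trans (eval₁-* (qpow h) _) (cong₂ _*ℤ_ (eval₁-qpow h) (eval₁-* (qbinom h k) (qbinom h k))) ⟩
    1ℤ *ℤ (eval₁ (qbinom h k) *ℤ eval₁ (qbinom h k))
      ≡⟨ trans (ℤP.*-identityˡ _) (cong₂ _*ℤ_ (eval₁-qbinom h k) (eval₁-qbinom h k)) ⟩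
    + (h C k) *ℤ + (h C k)
      ≡⟨ ℤP.pos-* (h C k) (h C k) ⟨
    + ((h C k) * (h C k)) ∎

qint-∣ₚ⇒∣ : ∀ n A N → qint n ∣ₚ A → eval₁ A ≡ + N → n ∣ N
qint-∣ₚ⇒∣ n A N (K , A≈Kn) evalA = divides ∣ eval₁ K ∣ (begin
  N                         ≡⟨⟩
  ∣ + N ∣                   ≡⟨ cong ∣_∣ evalA ⟨
  ∣ eval₁ A ∣               ≡⟨ cong ∣_∣ (eval₁-cong A (K *ₚ qint n) A≈Kn) ⟩
  ∣ eval₁ (K *ₚ qint n) ∣   ≡⟨ cong ∣_∣ (trans (eval₁-* K (qint n)) (cong (eval₁ K *ℤ_) (eval₁-qint n))) ⟩
  ∣ eval₁ K *ℤ + n ∣        ≡⟨ ℤP.abs-* (eval₁ K) (+ n) ⟩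
  ∣ eval₁ K ∣ * n           ∎)
  where open ≡-Reasoning

theorem3p1 : (n k : ℕ) → k < n →
    (B : ℕ → Poly) → (∀ h → IsQBinom h k (B h)) →
    (D : Poly) → IsQBinom (2 * k) k D →
    (qint n ∣ₚ qint (2 * k + 1) *ₚ D *ₚ sumₚ n (λ h → qpow h *ₚ (B h *ₚ B h)))
    × (n ∣ (2 * k + 1) * ((2 * k) C k) * sumℕ n (λ h → (h C k) * (h C k)))
theorem3p1 n k _ B isB D isD =
  ∣ₚ-resp (≋-sym replace) (qint-∣ₚ-central-sum n k) ,
  qint-∣ₚ⇒∣ n (centralSum n k) _ (qint-∣ₚ-central-sum n k) (eval₁-central-sum n k)
  where
  B≋ : ∀ h → B h ≋ qbinom h k
  B≋ h = isQBinom⇒qbinom h k (B h) (isB h)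
  replace : qint (2 * k + 1) *ₚ D *ₚ sumₚ n (λ h → qpow h *ₚ (B h *ₚ B h))
          ≋ centralSum n k
  replace = *ₚ-cong (*ₚ-cong (≋-refl {qint (2 * k + 1)}) (isQBinom⇒qbinom (2 * k) k D isD))
                    (sumₚ-cong n _ _ (λ h _ → *ₚ-cong (≋-refl {qpow h}) (*ₚ-cong (B≋ h) (B≋ h))))
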